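{- Let $q\ge8$ be even, $\mu\in\mathbb{F}_q^*\setminus\{1\}$, and let $\ell_\mu$ be the line through $R_{\mu,0}=\mathbf{P}(0,\mu,0,1)$ and $R_{\mu,\infty}=\mathbf{P}(1,0,1,0)$. Then $R_{\mu,\infty}$ lies on the tangent $\mathcal{T}_1$ and $R_{\mu,0}$ lies on the tangent $\mathcal{T}_{\sqrt{\mu}}$, and no other point of $\ell_\mu$ is a $T$-point. Consequently, for every $G_q$-orbit generated by a line $\ell_\mu$, $\mathrm{P}_T=2$.
   Context: $\mathbf{P}(x_0,\dots,x_3)$ is a point of $\mathrm{PG}(3,q)$. Twisted cubic $\mathcal{C}=\{\mathbf{P}(t^3,t^2,t,1):t\in\mathbb{F}_q\}\cup\{\mathbf{P}(1,0,0,0)\}$; $G_q$ = group of projectivities fixing $\mathcal{C}$. For $t\in\mathbb{F}_q$, $\mathcal{T}_t$ is the tangent to $\mathcal{C}$ at $\mathbf{P}(t^3,t^2,t,1)$, i.e. the line through it and $\mathbf{P}(3t^2,2t,1,0)$; $\mathcal{T}_\infty$ is the line through $\mathbf{P}(1,0,0,0)$ and $\mathbf{P}(0,1,0,0)$. $\sqrt{\mu}$ is the unique square root in characteristic 2. A $T$-point is a point off $\mathcal{C}$ on a tangent. $\mathrm{P}_T$ is the number of $T$-points on a line of the orbit. -}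

module Defs where

open import Level using (0ℓ)
open import Data.Nat using (ℕ)
open import Data.List using (List; length)
open import Data.List.Membership.Propositional using (_∈_)
open import Data.List.Relation.Unary.Unique.Propositional using (Unique)
open import Data.Product using (Σ; ∃; _×_; _,_)
open import Data.Sum using (_⊎_)
open import Relation.Nullary using (¬_)
open import Relation.Binary.PropositionalEquality using (_≡_)
open import Relation.Binary.Definitions using (DecidableEquality)
open import Algebra.Structures using (IsCommutativeRing)

record FiniteField : Set₁ where
  infixl 6 _+_
  infixl 7 _*_
  field
    F       : Set
    _+_ _*_ : F → F → F
    -_      : F → F
    0# 1#   : F
    isCommutativeRing : IsCommutativeRing _≡_ _+_ _*_ -_ 0# 1#
    0≢1     : ¬ (0# ≡ 1#)
    inverse : ∀ x → ¬ (x ≡ 0#) → Σ F (λ y → x * y ≡ 1#)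
    _≟_     : DecidableEquality F
    -- finiteness: an explicit duplicate-free enumeration of all elements
    elems    : List F
    complete : ∀ x → x ∈ elems
    unique   : Unique elems

  size : ℕ
  size = length elems

module Geo (K : FiniteField) where
  open FiniteField K

  -- vectors of F^4 (homogeneous coordinates)
  data V4 : Set where
    v4 : F → F → F → F → V4

  zeroV : V4
  zeroV = v4 0# 0# 0# 0#

  -- a vector represents a point of PG(3,q) iff it is nonzero
  NonZeroV : V4 → Set
  NonZeroV v = ¬ (v ≡ zeroV)

  _·_ : F → V4 → V4
  a · v4 x₀ x₁ x₂ x₃ = v4 (a * x₀) (a * x₁) (a * x₂) (a * x₃)

  _⊕_ : V4 → V4 → V4
  v4 x₀ x₁ x₂ x₃ ⊕ v4 y₀ y₁ y₂ y₃ = v4 (x₀ + y₀) (x₁ + y₁) (x₂ + y₂) (x₃ + y₃)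

  _≃_ : V4 → V4 → Set
  u ≃ v = Σ F (λ c → ¬ (c ≡ 0#) × u ≡ c · v)

  -- P(v) lies on the line through P(a) and P(b) (a, b independent)
  OnLine : V4 → V4 → V4 → Set
  OnLine a b v = Σ F (λ s → Σ F (λ t → v ≡ (s · a) ⊕ (t · b)))

  2# 3# : F
  2# = 1# + 1#
  3# = 1# + 1# + 1#

  cpt : F → V4
  cpt t = v4 (t * t * t) (t * t) t 1#

  cInf : V4
  cInf = v4 1# 0# 0# 0#

  OnC : V4 → Set
  OnC v = Σ F (λ t → v ≃ cpt t) ⊎ v ≃ cInf

  tdir : F → V4
  tdir t = v4 (3# * (t * t)) (2# * t) 1# 0#

  OnTangent : F → V4 → Set
  OnTangent t v = OnLine (cpt t) (tdir t) v

  OnTangentInf : V4 → Set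
  OnTangentInf v = OnLine cInf (v4 0# 1# 0# 0#) v

  TPoint : V4 → Set
  TPoint v = ¬ OnC v × (Σ F (λ t → OnTangent t v) ⊎ OnTangentInf v)

  R0 : F → V4
  R0 μ = v4 0# μ 0# 1#

  RInf : V4
  RInf = v4 1# 0# 1# 0#

-- A field of even order has characteristic 2, so squaring is injective (Frobenius) and hence
-- bijective on the finite field: μ has a square root s. In characteristic 2 the tangent direction
-- at P(u³,u²,u,1) is (u²,0,1,0), so T_u consists of the points (a u³ + b u², a u², a u + b, a).
-- A point (t, s μ, t, s) of ℓ_μ with s ≠ 0 on T_u forces a = s, μ = u² and then t = t u² = t μ,
-- so t = 0 because μ ≠ 1: it is R_{μ,0}. With s = 0 it is R_{μ,∞}, and no point of ℓ_μ lies on T_∞.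
module Submission where

open import Defs
open import Data.Nat using (_≤_)
open import Data.Nat.Divisibility using (_∣_)
open import Data.Product using (Σ; _×_)
open import Data.Sum using (_⊎_)
open import Relation.Nullary using (¬_)
open import Relation.Binary.PropositionalEquality using (_≡_)

open import Level using (Level)
open import Function using (_∘_)
open import Data.Empty using (⊥-elim)
open import Data.Nat as ℕ using (suc; z≤n; s≤s; _<_)
import Data.Nat.Properties as ℕ
open import Data.Nat.Divisibility using (_∣0; ∣m∣n⇒∣m+n; ∣m+n∣m⇒∣n; ∣1⇒≡1; ∣-refl)
open import Data.Product using (∃; _,_; proj₁; proj₂)
open import Data.Sum using (inj₁; inj₂)
open import Data.List using (List; []; _∷_; length; filter; map)
open import Data.List.Properties using (filter-accept; filter-reject; filter-all; filter-notAll; length-map)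
open import Data.List.Relation.Unary.Any as Any using (here; there)
import Data.List.Relation.Unary.All as All
open import Data.List.Relation.Unary.AllPairs using (_∷_)
open import Data.List.Relation.Unary.Unique.Propositional using (Unique)
import Data.List.Relation.Unary.Unique.Propositional.Properties as Unique
open import Data.List.Membership.Propositional using (_∈_)
open import Data.List.Membership.Propositional.Properties using (∈-filter⁺; ∈-filter⁻; ∈-map⁻)
open import Data.List.Relation.Binary.Subset.Propositional using (_⊆_)
open import Relation.Nullary using (Dec; yes; no; ¬?)
open import Relation.Binary.Definitions using (DecidableEquality)
open import Relation.Binary.PropositionalEquality using (refl; sym; trans; cong; cong₂; subst; module ≡-Reasoning)
open import Algebra.Bundles using (CommutativeRing)

module Enumeration {a : Level} {A : Set a} (_≟_ : DecidableEquality A) where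

  open import Data.List.Membership.DecPropositional _≟_ using (_∈?_)

  _≢?_ : (x y : A) → Dec (¬ x ≡ y)
  x ≢? y = ¬? (x ≟ y)

  remove : A → List A → List A
  remove x = filter (x ≢?_)

  ∈-remove⁺ : ∀ {x y xs} → y ∈ xs → ¬ x ≡ y → y ∈ remove x xs
  ∈-remove⁺ = ∈-filter⁺ _

  ∈-remove⁻ : ∀ {x y xs} → y ∈ remove x xs → y ∈ xs × ¬ x ≡ y
  ∈-remove⁻ = ∈-filter⁻ _

  Unique-remove : ∀ {x xs} → Unique xs → Unique (remove x xs)
  Unique-remove = Unique.filter⁺ _

  length-remove< : ∀ {x xs} → x ∈ xs → length (remove x xs) < length xs
  length-remove< {x} {xs} x∈xs = filter-notAll _ xs (Any.map (λ x≡y x≢y → x≢y x≡y) x∈xs)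

  length-remove : ∀ {x xs} → Unique xs → x ∈ xs → length xs ≡ suc (length (remove x xs))
  length-remove {x} {x ∷ ys} (x∉ys ∷ _) (here refl) =
    cong (suc ∘ length) (sym (trans (filter-reject (x ≢?_) (λ x≢x → x≢x refl)) (filter-all (x ≢?_) x∉ys)))
  length-remove {x} {y ∷ ys} (y∉ys ∷ u) (there x∈ys) =
    cong suc (trans (length-remove u x∈ys)
                    (cong length (sym (filter-accept (x ≢?_) (λ x≡y → All.lookup y∉ys x∈ys (sym x≡y))))))

  length-mono-⊆ : ∀ {xs ys} → Unique xs → xs ⊆ ys → length xs ≤ length ys
  length-mono-⊆ {[]} _ _ = z≤n
  length-mono-⊆ {x ∷ xs} {ys} (x∉xs ∷ u) x∷xs⊆ys =
    ℕ.≤-trans (s≤s (length-mono-⊆ u xs⊆ys-x)) (length-remove< (x∷xs⊆ys (here refl)))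
    where
    xs⊆ys-x : xs ⊆ remove x ys
    xs⊆ys-x z∈xs = ∈-remove⁺ (x∷xs⊆ys (there z∈xs)) (All.lookup x∉xs z∈xs)

  -- xs is paired off by the orbits {x, f x} of size 2.
  module _ (f : A → A) (f-involutive : ∀ x → f (f x) ≡ x) where

    f-injective : ∀ {x y} → f x ≡ f y → x ≡ y
    f-injective {x} {y} fx≡fy = trans (sym (f-involutive x)) (trans (cong f fx≡fy) (f-involutive y))

    even-length : ∀ {xs} → Unique xs → (∀ {x} → x ∈ xs → f x ∈ xs) → (∀ {x} → x ∈ xs → ¬ f x ≡ x) →
                  2 ∣ length xs
    even-length = bounded _ ℕ.≤-refl
      where
      bounded : ∀ n {xs} → length xs ≤ n → Unique xs →
                (∀ {x} → x ∈ xs → f x ∈ xs) → (∀ {x} → x ∈ xs → ¬ f x ≡ x) → 2 ∣ length xs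
      bounded _ {[]} _ _ _ _ = 2 ∣0
      bounded (suc n) {x ∷ ys} (s≤s |ys|≤n) (x∉ys ∷ u) closed fixFree with closed (here refl)
      ... | here fx≡x = ⊥-elim (fixFree (here refl) fx≡x)
      ... | there fx∈ys =
        subst (λ m → 2 ∣ suc m) (sym (length-remove u fx∈ys))
          (∣m∣n⇒∣m+n ∣-refl (bounded n |rest|≤n (Unique-remove u) closed-rest (fixFree ∘ there ∘ ∈-rest⇒∈ys)))
        where
        rest : List A
        rest = remove (f x) ys
        |rest|≤n : length rest ≤ n
        |rest|≤n = ℕ.≤-trans (ℕ.n≤1+n _) (ℕ.≤-trans (length-remove< fx∈ys) |ys|≤n)
        ∈-rest⇒∈ys : ∀ {z} → z ∈ rest → z ∈ ys
        ∈-rest⇒∈ys = proj₁ ∘ ∈-remove⁻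
        closed-rest : ∀ {z} → z ∈ rest → f z ∈ rest
        closed-rest z∈rest with ∈-remove⁻ z∈rest
        ... | z∈ys , fx≢z with closed (there z∈ys)
        ...   | here fz≡x = ⊥-elim (fx≢z (trans (cong f (sym fz≡x)) (f-involutive _)))
        ...   | there fz∈ys = ∈-remove⁺ fz∈ys (All.lookup x∉ys z∈ys ∘ f-injective)

  injective⇒surjective : ∀ {xs} → Unique xs → (∀ x → x ∈ xs) →
                         (f : A → A) → (∀ {x y} → f x ≡ f y → x ≡ y) → ∀ y → ∃ λ x → f x ≡ y
  injective⇒surjective {xs} unique complete f f-injective y with y ∈? map f xs
  ... | yes y∈fxs with ∈-map⁻ f y∈fxs
  ...   | x , _ , y≡fx = x , sym y≡fx
  injective⇒surjective {xs} unique complete f f-injective y | no y∉fxs =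
    ⊥-elim (ℕ.<-irrefl refl (begin-strict
      length xs           ≡⟨ length-map f xs ⟨
      length (map f xs)   ≤⟨ length-mono-⊆ (Unique.map⁺ f-injective unique) fxs⊆xs-y ⟩
      length (remove y xs) <⟨ length-remove< (complete y) ⟩
      length xs           ∎))
    where
    open ℕ.≤-Reasoning
    fxs⊆xs-y : map f xs ⊆ remove y xs
    fxs⊆xs-y {z} z∈fxs = ∈-remove⁺ (complete z) (λ y≡z → y∉fxs (subst (_∈ map f xs) (sym y≡z) z∈fxs))

module FiniteFieldProperties (K : FiniteField) where
  open FiniteField K
  open Geo K using (2#)

  ring : CommutativeRing Level.zero Level.zero
  ring = record { isCommutativeRing = isCommutativeRing }

  open CommutativeRing ring using (commutativeSemiring; -‿inverseʳ)
  open CommutativeRing ring public using (zeroˡ; zeroʳ; *-identityˡ; *-identityʳ; +-identityˡ; +-identityʳ)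
  open import Algebra.Properties.Ring (CommutativeRing.ring ring) using (-0#≈0#; -‿involutive)
  open import Algebra.Solver.Ring.NaturalCoefficients.Default commutativeSemiring public
    using (solve; _:=_; _:+_; _:*_; con)
  open Enumeration _≟_
  open ≡-Reasoning

  *-cancelˡ : ∀ {s} x y → ¬ s ≡ 0# → s * x ≡ s * y → x ≡ y
  *-cancelˡ {s} x y s≢0 sx≡sy with inverse s s≢0
  ... | s⁻¹ , ss⁻¹≡1 = begin
    x              ≡⟨ undo x ⟨
    s⁻¹ * (s * x)  ≡⟨ cong (s⁻¹ *_) sx≡sy ⟩
    s⁻¹ * (s * y)  ≡⟨ undo y ⟩
    y              ∎
    where
    undo : ∀ z → s⁻¹ * (s * z) ≡ z
    undo z = begin
      s⁻¹ * (s * z)  ≡⟨ solve 3 (λ a b c → a :* (b :* c) := (b :* a) :* c) refl s⁻¹ s z ⟩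
      s * s⁻¹ * z    ≡⟨ cong (_* z) ss⁻¹≡1 ⟩
      1# * z         ≡⟨ *-identityˡ z ⟩
      z              ∎

  noZeroDivisors : ∀ x y → x * y ≡ 0# → x ≡ 0# ⊎ y ≡ 0#
  noZeroDivisors x y xy≡0 with x ≟ 0#
  ... | yes x≡0 = inj₁ x≡0
  ... | no x≢0 = inj₂ (*-cancelˡ y 0# x≢0 (trans xy≡0 (sym (zeroʳ x))))

  *-fixed⇒0 : ∀ {t μ} → ¬ μ ≡ 1# → t * μ ≡ t → t ≡ 0#
  *-fixed⇒0 {t} {μ} μ≢1 tμ≡t with t ≟ 0#
  ... | yes t≡0 = t≡0
  ... | no t≢0 = ⊥-elim (μ≢1 (*-cancelˡ μ 1# t≢0 (trans tμ≡t (sym (*-identityʳ t)))))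

  -- Outside characteristic 2, x ↦ - x is a fixed-point-free involution of the q - 1 units.
  even-order⇒char2 : 2 ∣ size → 2# ≡ 0#
  even-order⇒char2 2∣q with 2# ≟ 0#
  ... | yes 2≡0 = 2≡0
  ... | no 2≢0 = ⊥-elim (2∤1 (∣m+n∣m⇒∣n (subst (2 ∣_) q≡units+1 2∣q) 2∣units))
    where
    units : List F
    units = remove 0# elems
    2∤1 : ¬ 2 ∣ 1
    2∤1 2∣1 with ∣1⇒≡1 2∣1
    ... | ()
    q≡units+1 : size ≡ length units ℕ.+ 1
    q≡units+1 = trans (length-remove unique (complete 0#)) (ℕ.+-comm 1 _)
    -x≡x⇒x≡0 : ∀ {x} → - x ≡ x → x ≡ 0#
    -x≡x⇒x≡0 {x} -x≡x with noZeroDivisors x 2# (begin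
      x * 2#   ≡⟨ solve 1 (λ x → x :* (con 1 :+ con 1) := x :+ x) refl x ⟩
      x + x    ≡⟨ cong (x +_) -x≡x ⟨
      x + - x  ≡⟨ -‿inverseʳ x ⟩
      0#       ∎)
    ... | inj₁ x≡0 = x≡0
    ... | inj₂ 2≡0 = ⊥-elim (2≢0 2≡0)
    closed : ∀ {x} → x ∈ units → - x ∈ units
    closed {x} x∈units = ∈-remove⁺ (complete (- x)) λ 0≡-x →
      proj₂ (∈-remove⁻ {xs = elems} x∈units) (sym (trans (sym (-‿involutive x)) (trans (cong -_ (sym 0≡-x)) -0#≈0#)))
    fixFree : ∀ {x} → x ∈ units → ¬ - x ≡ x
    fixFree x∈units -x≡x = proj₂ (∈-remove⁻ {xs = elems} x∈units) (sym (-x≡x⇒x≡0 -x≡x))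
    2∣units : 2 ∣ length units
    2∣units = even-length -_ -‿involutive (Unique-remove unique) closed fixFree

  module Char2 (2≡0 : 2# ≡ 0#) where

    x+x≡0 : ∀ x → x + x ≡ 0#
    x+x≡0 x = begin
      x + x    ≡⟨ solve 1 (λ x → x :+ x := (con 1 :+ con 1) :* x) refl x ⟩
      2# * x   ≡⟨ cong (_* x) 2≡0 ⟩
      0# * x   ≡⟨ zeroˡ x ⟩
      0#       ∎

    square-injective : ∀ {x y} → x * x ≡ y * y → x ≡ y
    square-injective {x} {y} xx≡yy = begin
      x              ≡⟨ +-identityʳ x ⟨
      x + 0#         ≡⟨ cong (x +_) (x+x≡0 y) ⟨
      x + (y + y)    ≡⟨ solve 2 (λ x y → x :+ (y :+ y) := (x :+ y) :+ y) refl x y ⟩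
      (x + y) + y    ≡⟨ cong (_+ y) x+y≡0 ⟩
      0# + y         ≡⟨ +-identityˡ y ⟩
      y              ∎
      where
      x+y≡0 : x + y ≡ 0#
      x+y≡0 with noZeroDivisors (x + y) (x + y) (begin
        (x + y) * (x + y)              ≡⟨ solve 2 (λ x y → (x :+ y) :* (x :+ y) := x :* x :+ y :* y :+ (x :* y :+ x :* y)) refl x y ⟩
        x * x + y * y + (x * y + x * y) ≡⟨ cong₂ _+_ (trans (cong (_+ y * y) xx≡yy) (x+x≡0 _)) (x+x≡0 _) ⟩
        0# + 0#                         ≡⟨ +-identityˡ 0# ⟩
        0#                              ∎)
      ... | inj₁ p = p
      ... | inj₂ p = p

    sqrt : ∀ μ → ∃ λ s → s * s ≡ μ
    sqrt = injective⇒surjective unique complete (λ x → x * x) square-injective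

module TwistedCubic (K : FiniteField) where
  open FiniteField K
  open Geo K
  open FiniteFieldProperties K
  open ≡-Reasoning

  v4-injective : ∀ {a b c d a′ b′ c′ d′} → v4 a b c d ≡ v4 a′ b′ c′ d′ →
                 a ≡ a′ × b ≡ b′ × c ≡ c′ × d ≡ d′
  v4-injective refl = refl , refl , refl , refl

  v4-cong : ∀ {a b c d a′ b′ c′ d′} → a ≡ a′ → b ≡ b′ → c ≡ c′ → d ≡ d′ → v4 a b c d ≡ v4 a′ b′ c′ d′
  v4-cong refl refl refl refl = refl

  0·≡zeroV : ∀ w → 0# · w ≡ zeroV
  0·≡zeroV (v4 a b c d) = v4-cong (zeroˡ a) (zeroˡ b) (zeroˡ c) (zeroˡ d)

  0·-⊕ : ∀ w u → (0# · w) ⊕ u ≡ u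
  0·-⊕ w u@(v4 a b c d) rewrite 0·≡zeroV w =
    v4-cong (+-identityˡ a) (+-identityˡ b) (+-identityˡ c) (+-identityˡ d)

  ⊕-0· : ∀ u w → u ⊕ (0# · w) ≡ u
  ⊕-0· u@(v4 a b c d) w rewrite 0·≡zeroV w =
    v4-cong (+-identityʳ a) (+-identityʳ b) (+-identityʳ c) (+-identityʳ d)

  ℓ-point : ∀ μ s t → (s · R0 μ) ⊕ (t · RInf) ≡ v4 t (s * μ) t s
  ℓ-point μ s t = v4-cong
    (solve 2 (λ s t → s :* con 0 :+ t :* con 1 := t) refl s t)
    (solve 3 (λ s t μ → s :* μ :+ t :* con 0 := s :* μ) refl s t μ)
    (solve 2 (λ s t → s :* con 0 :+ t :* con 1 := t) refl s t)
    (solve 2 (λ s t → s :* con 1 :+ t :* con 0 := s) refl s t)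

  1≢c*0 : ∀ c → ¬ 1# ≡ c * 0#
  1≢c*0 c 1≡c*0 = 0≢1 (sym (trans 1≡c*0 (zeroʳ c)))

  RInf-∉C : ¬ OnC RInf
  RInf-∉C (inj₁ (t , c , c≢0 , RInf≡)) with v4-injective RInf≡
  ... | _ , _ , _ , 0≡c*1 = c≢0 (sym (trans 0≡c*1 (*-identityʳ c)))
  RInf-∉C (inj₂ (c , _ , RInf≡)) with v4-injective RInf≡
  ... | _ , _ , 1≡c*0 , _ = 1≢c*0 c 1≡c*0

  R0-∉C : ∀ {μ} → ¬ μ ≡ 0# → ¬ OnC (R0 μ)
  R0-∉C {μ} μ≢0 (inj₁ (t , c , _ , R0≡)) with v4-injective R0≡
  ... | _ , μ≡ctt , 0≡ct , _ = μ≢0 (begin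
    μ            ≡⟨ μ≡ctt ⟩
    c * (t * t)  ≡⟨ solve 2 (λ c t → c :* (t :* t) := (c :* t) :* t) refl c t ⟩
    (c * t) * t  ≡⟨ cong (_* t) 0≡ct ⟨
    0# * t       ≡⟨ zeroˡ t ⟩
    0#           ∎)
  R0-∉C μ≢0 (inj₂ (c , _ , R0≡)) with v4-injective R0≡
  ... | _ , _ , _ , 1≡c*0 = 1≢c*0 c 1≡c*0

  R0≄RInf : ∀ {μ} → ¬ R0 μ ≃ RInf
  R0≄RInf (c , _ , R0≡) with v4-injective R0≡
  ... | _ , _ , _ , 1≡c*0 = 1≢c*0 c 1≡c*0

  ℓ-∉T∞ : ∀ {μ s t} → ¬ s ≡ 0# → ¬ OnTangentInf (v4 t (s * μ) t s)
  ℓ-∉T∞ {s = s} s≢0 (a , b , ℓ≡) with v4-injective ℓ≡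
  ... | _ , _ , _ , s≡ = s≢0 (trans s≡ (solve 2 (λ a b → a :* con 0 :+ b :* con 0 := con 0) refl a b))

  module TangentsInChar2 (2≡0 : 2# ≡ 0#) where
    open Char2 2≡0

    3≡1 : 3# ≡ 1#
    3≡1 = trans (cong (_+ 1#) 2≡0) (+-identityˡ 1#)

    tdir-char2 : ∀ u → tdir u ≡ v4 (u * u) 0# 1# 0#
    tdir-char2 u = v4-cong (trans (cong (_* (u * u)) 3≡1) (*-identityˡ (u * u)))
                           (trans (cong (_* u) 2≡0) (zeroˡ u)) refl refl

    tangent-point : ∀ u a b → (a · cpt u) ⊕ (b · tdir u) ≡
                              v4 (a * (u * u * u) + b * (u * u)) (a * (u * u)) (a * u + b) a
    tangent-point u a b = trans (cong (λ w → (a · cpt u) ⊕ (b · w)) (tdir-char2 u)) (v4-cong refl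
      (solve 3 (λ a b u → a :* (u :* u) :+ b :* con 0 := a :* (u :* u)) refl a b u)
      (solve 3 (λ a b u → a :* u :+ b :* con 1 := a :* u :+ b) refl a b u)
      (solve 2 (λ a b → a :* con 1 :+ b :* con 0 := a) refl a b))

    RInf-on-T₁ : OnTangent 1# RInf
    RInf-on-T₁ = 0# , 1# , sym (trans (tangent-point 1# 0# 1#) (v4-cong
      (solve 0 (con 0 :* (con 1 :* con 1 :* con 1) :+ con 1 :* (con 1 :* con 1) := con 1) refl)
      (zeroˡ (1# * 1#))
      (solve 0 (con 0 :* con 1 :+ con 1 := con 1) refl)
      refl))

    R0-on-Tₛ : ∀ {s μ} → s * s ≡ μ → OnTangent s (R0 μ)
    R0-on-Tₛ {s} refl = 1# , s , sym (trans (tangent-point s 1# s) (v4-cong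
      (trans (solve 1 (λ s → con 1 :* (s :* s :* s) :+ s :* (s :* s) := s :* s :* s :+ s :* s :* s) refl s)
             (x+x≡0 (s * s * s)))
      (*-identityˡ (s * s))
      (trans (cong (_+ s) (*-identityˡ s)) (x+x≡0 s))
      refl))

    ℓ-on-Tᵤ⇒tμ≡t : ∀ {μ s t u} → ¬ s ≡ 0# → OnTangent u (v4 t (s * μ) t s) → t * μ ≡ t
    ℓ-on-Tᵤ⇒tμ≡t {μ} {s} {t} {u} s≢0 (a , b , ℓ≡) with v4-injective (trans ℓ≡ (tangent-point u a b))
    ... | t≡au³+bu² , sμ≡au² , t≡au+b , s≡a = begin
      t * μ                    ≡⟨ cong (t *_) μ≡u² ⟩
      t * (u * u)              ≡⟨ cong (_* (u * u)) t≡au+b ⟩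
      (a * u + b) * (u * u)    ≡⟨ solve 3 (λ a b u → (a :* u :+ b) :* (u :* u) := a :* (u :* u :* u) :+ b :* (u :* u)) refl a b u ⟩
      a * (u * u * u) + b * (u * u) ≡⟨ t≡au³+bu² ⟨
      t                        ∎
      where
      μ≡u² : μ ≡ u * u
      μ≡u² = *-cancelˡ μ (u * u) s≢0 (trans sμ≡au² (cong (_* (u * u)) (sym s≡a)))

    ℓ-TPoint≃R0⊎RInf : ∀ {μ} → ¬ μ ≡ 1# → ∀ v → NonZeroV v → OnLine (R0 μ) RInf v → TPoint v →
                v ≃ R0 μ ⊎ v ≃ RInf
    ℓ-TPoint≃R0⊎RInf {μ} μ≢1 v v≢0 (s , t , v≡) (_ , onTangent) with s ≟ 0#
    ... | yes refl = inj₂ (t , t≢0 , trans v≡ (0·-⊕ (R0 μ) (t · RInf)))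
      where
      t≢0 : ¬ t ≡ 0#
      t≢0 refl = v≢0 (trans v≡ (trans (0·-⊕ (R0 μ) (0# · RInf)) (0·≡zeroV RInf)))
    ... | no s≢0 = inj₁ (s , s≢0 , trans v≡ (trans (cong (λ c → (s · R0 μ) ⊕ (c · RInf)) t≡0) (⊕-0· (s · R0 μ) RInf)))
      where
      onℓ : v ≡ v4 t (s * μ) t s
      onℓ = trans v≡ (ℓ-point μ s t)
      tangent⇒t≡0 : Σ F (λ u → OnTangent u v) ⊎ OnTangentInf v → t ≡ 0#
      tangent⇒t≡0 (inj₁ (u , onTᵤ)) = *-fixed⇒0 μ≢1 (ℓ-on-Tᵤ⇒tμ≡t s≢0 (subst (OnTangent u) onℓ onTᵤ))
      tangent⇒t≡0 (inj₂ onT∞) = ⊥-elim (ℓ-∉T∞ s≢0 (subst OnTangentInf onℓ onT∞))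
      t≡0 : t ≡ 0#
      t≡0 = tangent⇒t≡0 onTangent

mainTheorem12 :
  (K : FiniteField) →
  let open FiniteField K
      open Geo K
  in 2 ∣ size → 8 ≤ size →
     (μ : F) → ¬ (μ ≡ 0#) → ¬ (μ ≡ 1#) →
     OnTangent 1# RInf
     × Σ F (λ s → s * s ≡ μ × OnTangent s (R0 μ))
     × TPoint RInf × TPoint (R0 μ) × ¬ (R0 μ ≃ RInf)
     × ((v : V4) → NonZeroV v → OnLine (R0 μ) RInf v → TPoint v →
          v ≃ R0 μ ⊎ v ≃ RInf)
mainTheorem12 K 2∣q _ μ μ≢0 μ≢1 =
  RInf-on-T₁ , (s , s²≡μ , R0-on-Tₛ s²≡μ) ,
  (RInf-∉C , inj₁ (1# , RInf-on-T₁)) , (R0-∉C μ≢0 , inj₁ (s , R0-on-Tₛ s²≡μ)) ,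
  R0≄RInf , ℓ-TPoint≃R0⊎RInf μ≢1
  where
  open FiniteField K
  open FiniteFieldProperties K using (even-order⇒char2; module Char2)
  open TwistedCubic K
  open Geo K using (2#)
  char2 : 2# ≡ 0#
  char2 = even-order⇒char2 2∣q
  open TangentsInChar2 char2
  open Char2 char2 using (sqrt)
  s : F
  s = proj₁ (sqrt μ)
  s²≡μ : s * s ≡ μ
  s²≡μ = proj₂ (sqrt μ)
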